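{- Let $m,r_1,r_2$ be integers with $m\ge2$, $0<r_1<m$, $0<r_2<m$, $r_1\ne r_2$. For integers $a,b,n\ge0$ let $\gamma(m,r_1,r_2,a,b,n)$ be the number of $(m,r_1,r_2)$-capsids $\lambda$ with $|\lambda|=n$, $\alpha(\lambda)=a$ and $\beta(\lambda)=b$. Then for all $a,b,n\ge 0$, \[ \gamma(m,r_1,r_2,a,b,n)=\gamma(m,r_2,r_1,b,a,n). \]
   Context: $|\lambda|$ is the sum of parts of $\lambda$. Write a partition as $(1^{\mu_1},2^{\mu_2},\dots)$ with $\mu_j$ the multiplicity of part $j$. A partition $\pi$ is an $(m,r_1,r_2)$-capsid if every part is equal to $r_1$ or congruent to $0$ or $r_2$ mod $m$, and: (i) if $\mu_{r_1}=0$ then all parts are congruent to $r_2$ mod $m$; (ii) if $\mu_{r_1}>0$ then $r_1$ is the smallest part, every part congruent to $0$ mod $m$ is $\le m\mu_{r_1}$, and all parts congruent to $r_2$ mod $m$ are $>m\mu_{r_1}$. The empty partition is included. For an $(m,r_1,r_2)$-capsid $\lambda$, $\alpha(\lambda)=\mu_{r_1}$ and $\beta(\lambda)$ is the number of parts of $\lambda$ congruent to $r_2$ mod $m$. (For $(m,r_2,r_1)$-capsids the roles of $r_1$ and $r_2$ are swapped in all of these definitions.) -}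

module Defs where

open import Data.Nat using (ℕ; zero; suc; _+_; _*_; _∸_; _⊓_; _≤_; _<_; _≟_; _≤?_; _<?_; NonZero)
open import Data.Nat.DivMod using (_%_)
open import Data.List using (List; []; _∷_; [_]; map; concatMap; upTo; filter; length)
open import Data.List.Relation.Unary.All using (All; all?)
open import Data.Product using (_×_)
open import Data.Sum using (_⊎_)
open import Relation.Nullary using (Dec)
open import Relation.Nullary.Decidable using (_×-dec_; _⊎-dec_; _→-dec_)
open import Relation.Binary.PropositionalEquality using (_≡_)

-- A partition is represented as a list of positive parts in non-increasing order.
-- partsFuel f n k : all partitions of n whose largest part is ≤ k (fuel f ≥ n).
partsFuel : ℕ → ℕ → ℕ → List (List ℕ)
partsFuel _ zero _ = [ [] ]
partsFuel zero (suc n) _ = []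
partsFuel (suc f) (suc n) k =
  concatMap (λ j → map (j ∷_) (partsFuel f (suc n ∸ j) j)) (map suc (upTo (k ⊓ suc n)))

partitions : ℕ → List (List ℕ)
partitions n = partsFuel n n n


mult : ℕ → List ℕ → ℕ
mult j ps = length (filter (λ p → p ≟ j) ps)

module _ (m : ℕ) .{{_ : NonZero m}} where

  countRes : ℕ → List ℕ → ℕ
  countRes r ps = length (filter (λ p → p % m ≟ r) ps)

  IsCapsid : ℕ → ℕ → List ℕ → Set
  IsCapsid r₁ r₂ ps =
    All (λ p → p ≡ r₁ ⊎ (p % m ≡ 0 ⊎ p % m ≡ r₂)) ps
    × (mult r₁ ps ≡ 0 → All (λ p → p % m ≡ r₂) ps)
    × (0 < mult r₁ ps →
         All (λ p → r₁ ≤ p) ps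
         × All (λ p → p % m ≡ 0 → p ≤ m * mult r₁ ps) ps
         × All (λ p → p % m ≡ r₂ → m * mult r₁ ps < p) ps)

  isCapsid? : ∀ r₁ r₂ ps → Dec (IsCapsid r₁ r₂ ps)
  isCapsid? r₁ r₂ ps =
    all? (λ p → (p ≟ r₁) ⊎-dec ((p % m ≟ 0) ⊎-dec (p % m ≟ r₂))) ps
    ×-dec ((mult r₁ ps ≟ 0) →-dec all? (λ p → p % m ≟ r₂) ps)
    ×-dec ((0 <? mult r₁ ps) →-dec
             (all? (λ p → r₁ ≤? p) ps
              ×-dec all? (λ p → (p % m ≟ 0) →-dec (p ≤? m * mult r₁ ps)) ps
              ×-dec all? (λ p → (p % m ≟ r₂) →-dec (m * mult r₁ ps <? p)) ps))

  α : ℕ → ℕ → List ℕ → ℕ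
  α r₁ r₂ ps = mult r₁ ps

  β : ℕ → ℕ → List ℕ → ℕ
  β r₁ r₂ ps = countRes r₂ ps

  γ : ℕ → ℕ → ℕ → ℕ → ℕ → ℕ
  γ r₁ r₂ a b n =
    length (filter (λ qs → isCapsid? r₁ r₂ qs ×-dec (α r₁ r₂ qs ≟ a) ×-dec (β r₁ r₂ qs ≟ b))
                   (partitions n))

module Submission where

-- An (m, r₁, r₂)-capsid λ with α(λ) = a and β(λ) = b consists of a copies of r₁, parts j · m with
-- 1 ≤ j ≤ a, and b parts r₂ + (a + k) · m with k ≥ 0.  Record the multiples of m by their multiplicity
-- vector e ∈ ℕᵃ and the quotients k₁ ≥ … ≥ k_b by their difference vector d ∈ ℕᵇ.  Then
--   |λ| = b r₂ + a r₁ + (a b + w(d) + w(e)) m,   where w(v) = Σᵢ (i + 1) vᵢ,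
-- which is invariant under (r₁, a, e) ↔ (r₂, b, d).  So swapping d and e is a size-preserving bijection
-- from (m, r₁, r₂)-capsids onto (m, r₂, r₁)-capsids exchanging α and β, and it transports the count
-- along the duplicate-free enumeration of the partitions of n.

open import Data.Nat
  using (ℕ; zero; suc; _+_; _*_; _∸_; _⊓_; _≤_; _≥_; _<_; _≟_; _<?_; z≤n; s≤s; z<s; s≤s⁻¹; NonZero; >-nonZero⁻¹)
open import Data.Nat.Properties
open import Data.Nat.DivMod
open import Data.Nat.Divisibility using (∣-refl; n∣m*n)
open import Data.Nat.ListAction using (sum)
open import Data.Nat.ListAction.Properties using (sum-++)
open import Data.Nat.Tactic.RingSolver using (solve-∀)
open import Data.List using (List; []; _∷_; map; concatMap; upTo; filter; length; _++_; replicate; applyUpTo)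
open import Data.List.Properties
  using ( length-map; length-++; length-applyUpTo; length-replicate; length-removeAt′; ∷-injective; ∷-injectiveʳ
        ; ++-identityʳ; map-∘; map-id-local; filter-accept; filter-reject; filter-++; filter-all; filter-none)
open import Data.List.Relation.Unary.All as All using (All; []; _∷_)
import Data.List.Relation.Unary.All.Properties as AllP
open import Data.List.Relation.Unary.AllPairs as AllPairs using (AllPairs; []; _∷_)
import Data.List.Relation.Unary.AllPairs.Properties as AllPairs
open import Data.List.Relation.Unary.Any using (here; there; _─_)
open import Data.List.Relation.Unary.Unique.Propositional using (Unique)
import Data.List.Relation.Unary.Unique.Propositional.Properties as Unique
open import Data.List.Relation.Binary.Subset.Propositional using (_⊆_)
open import Data.List.Membership.Propositional using (_∈_; find; lose)
open import Data.List.Membership.Propositional.Properties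
  using (∈-map⁺; ∈-map⁻; ∈-filter⁺; ∈-filter⁻; ∈-concatMap⁺; ∈-concatMap⁻; ∈-upTo⁺; ∈-upTo⁻)
open import Data.Product using (_×_; _,_; proj₁; proj₂; swap)
open import Data.Sum using (_⊎_; inj₁; inj₂)
open import Data.Empty using (⊥; ⊥-elim)
open import Function using (_∘_)
open import Relation.Unary using (Decidable)
open import Relation.Nullary using (yes; no)
open import Relation.Nullary.Negation using (contradiction)
open import Relation.Binary.Definitions using (tri<; tri≈; tri>)
open import Relation.Binary.PropositionalEquality
  using (_≡_; _≢_; refl; sym; trans; cong; cong₂; subst; ≢-sym; module ≡-Reasoning)

open import Defs

-- Counting through a bijection

module _ {A : Set} where

  ∈-─ : ∀ {x y : A} {xs} → y ∈ xs → y ≢ x → (x∈xs : x ∈ xs) → y ∈ (xs ─ x∈xs)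
  ∈-─ (here refl) y≢x (here refl) = ⊥-elim (y≢x refl)
  ∈-─ (there y∈xs) _ (here _) = y∈xs
  ∈-─ (here y≡z) _ (there _) = here y≡z
  ∈-─ (there y∈xs) y≢x (there x∈xs) = there (∈-─ y∈xs y≢x x∈xs)

  Unique-⊆⇒length-≤ : ∀ {xs ys : List A} → Unique xs → xs ⊆ ys → length xs ≤ length ys
  Unique-⊆⇒length-≤ [] _ = z≤n
  Unique-⊆⇒length-≤ {x ∷ xs} {ys} (x∉xs ∷ xs!) xs⊆ys = begin
    suc (length xs)          ≤⟨ s≤s (Unique-⊆⇒length-≤ xs! xs⊆ys─x) ⟩
    suc (length (ys ─ x∈ys)) ≡⟨ sym (length-removeAt′ ys _) ⟩
    length ys                ∎
    where
    open ≤-Reasoning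
    x∈ys = xs⊆ys (here refl)
    xs⊆ys─x : xs ⊆ (ys ─ x∈ys)
    xs⊆ys─x y∈xs = ∈-─ (xs⊆ys (there y∈xs)) (≢-sym (All.lookup x∉xs y∈xs)) x∈ys

  map⁺-Unique-injectiveOn : ∀ (f : A → A) {xs} → Unique xs →
    (∀ {x y} → x ∈ xs → y ∈ xs → f x ≡ f y → x ≡ y) → Unique (map f xs)
  map⁺-Unique-injectiveOn f [] _ = []
  map⁺-Unique-injectiveOn f {x ∷ xs} (x∉xs ∷ xs!) inj =
    AllP.map⁺ (All.tabulate (λ y∈xs fx≡fy → All.lookup x∉xs y∈xs (inj (here refl) (there y∈xs) fx≡fy)))
    ∷ map⁺-Unique-injectiveOn f xs! (λ x∈ y∈ → inj (there x∈) (there y∈))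

  length-filter-≤-viaLeftInverse : ∀ {P Q : A → Set} (P? : Decidable P) (Q? : Decidable Q) {xs ys} →
    Unique xs → (f g : A → A) →
    (∀ {x} → x ∈ xs → P x → f x ∈ ys × Q (f x) × g (f x) ≡ x) →
    length (filter P? xs) ≤ length (filter Q? ys)
  length-filter-≤-viaLeftInverse P? Q? {xs} {ys} xs! f g f-into = begin
    length (filter P? xs)         ≡⟨ length-map f (filter P? xs) ⟨
    length (map f (filter P? xs)) ≤⟨ Unique-⊆⇒length-≤ image! image⊆ ⟩
    length (filter Q? ys)         ∎
    where
    open ≤-Reasoning
    image! : Unique (map f (filter P? xs))
    image! = map⁺-Unique-injectiveOn f (Unique.filter⁺ P? xs!) λ x∈ y∈ fx≡fy →
      let (x∈xs , Px) = ∈-filter⁻ P? x∈ ; (y∈xs , Py) = ∈-filter⁻ P? y∈ in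
      trans (sym (proj₂ (proj₂ (f-into x∈xs Px))))
            (trans (cong g fx≡fy) (proj₂ (proj₂ (f-into y∈xs Py))))
    image⊆ : map f (filter P? xs) ⊆ filter Q? ys
    image⊆ fx∈ with ∈-map⁻ f fx∈
    ... | x , x∈ , refl =
      let (x∈xs , Px) = ∈-filter⁻ P? x∈ ; (fx∈ys , Qfx , _) = f-into x∈xs Px in
      ∈-filter⁺ Q? fx∈ys Qfx

  length-filter-≡-viaInverse : ∀ {P Q : A → Set} (P? : Decidable P) (Q? : Decidable Q) {xs ys} →
    Unique xs → Unique ys → (f g : A → A) →
    (∀ {x} → x ∈ xs → P x → f x ∈ ys × Q (f x) × g (f x) ≡ x) →
    (∀ {y} → y ∈ ys → Q y → g y ∈ xs × P (g y) × f (g y) ≡ y) →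
    length (filter P? xs) ≡ length (filter Q? ys)
  length-filter-≡-viaInverse P? Q? xs! ys! f g f-into g-into = ≤-antisym
    (length-filter-≤-viaLeftInverse P? Q? xs! f g f-into)
    (length-filter-≤-viaLeftInverse Q? P? ys! g f g-into)

-- Partitions

Nonincreasing : List ℕ → Set
Nonincreasing = AllPairs _≥_

Nonincreasing-replicate : ∀ e v → Nonincreasing (replicate e v)
Nonincreasing-replicate zero _ = []
Nonincreasing-replicate (suc e) v = AllP.replicate⁺ e ≤-refl ∷ Nonincreasing-replicate e v

partsStartingWith : ℕ → ℕ → ℕ → List (List ℕ)
partsStartingWith f n j = map (j ∷_) (partsFuel f (n ∸ j) j)

partsFuel-sound : ∀ f n k {xs} → xs ∈ partsFuel f n k →
  Nonincreasing xs × All (0 <_) xs × sum xs ≡ n × All (_≤ k) xs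
partsFuel-sound f zero k (here refl) = [] , [] , refl , []
partsFuel-sound (suc f) (suc n) k xs∈
  with find (∈-concatMap⁻ (partsStartingWith f (suc n)) {xs = map suc (upTo (k ⊓ suc n))} xs∈)
... | j , j∈ , xs∈ⱼ with ∈-map⁻ suc j∈ | ∈-map⁻ (j ∷_) xs∈ⱼ
... | i , i∈ , refl | ys , ys∈ , refl with partsFuel-sound f (suc n ∸ suc i) (suc i) ys∈
... | ys↓ , ys>0 , Σys , ys≤j =
  (ys≤j ∷ ys↓) ,
  (z<s ∷ ys>0) ,
  trans (cong (suc i +_) Σys) (m+[n∸m]≡n j≤n) ,
  (j≤k ∷ All.map (λ y≤j → ≤-trans y≤j j≤k) ys≤j)
  where
  j≤k = ≤-trans (∈-upTo⁻ i∈) (m⊓n≤m k (suc n))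
  j≤n = ≤-trans (∈-upTo⁻ i∈) (m⊓n≤n k (suc n))

partsFuel-complete : ∀ f k {xs} → Nonincreasing xs → All (0 <_) xs → All (_≤ k) xs → sum xs ≤ f →
  xs ∈ partsFuel f (sum xs) k
partsFuel-complete f k {[]} _ _ _ _ = here refl
partsFuel-complete f k {zero ∷ xs} _ (() ∷ _) _ _
partsFuel-complete (suc f) k {suc x ∷ xs} (xs≤x ∷ xs↓) (_ ∷ xs>0) (x<k ∷ _) (s≤s Σ≤f) =
  ∈-concatMap⁺ (partsStartingWith f n) {xs = map suc (upTo (k ⊓ n))}
    (lose (∈-map⁺ suc (∈-upTo⁺ (⊓-glb x<k (s≤s (m≤m+n x (sum xs))))))
      (∈-map⁺ (suc x ∷_) (subst (λ t → xs ∈ partsFuel f t (suc x)) (sym (m+n∸m≡n x (sum xs)))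
        (partsFuel-complete f (suc x) xs↓ xs>0 xs≤x (≤-trans (m≤n+m (sum xs) x) Σ≤f)))))
  where
  n = suc (x + sum xs)

partsFuel-unique : ∀ f n k → Unique (partsFuel f n k)
partsFuel-unique f zero k = [] ∷ []
partsFuel-unique zero (suc n) k = []
partsFuel-unique (suc f) (suc n) k =
  concat-unique (map suc (upTo (k ⊓ suc n))) (Unique.map⁺ suc-injective (Unique.upTo⁺ _))
  where
  concat-unique : ∀ js → Unique js → Unique (concatMap (partsStartingWith f (suc n)) js)
  concat-unique [] _ = []
  concat-unique (j ∷ js) (j∉js ∷ js!) =
    Unique.++⁺ (Unique.map⁺ ∷-injectiveʳ (partsFuel-unique f (suc n ∸ j) j)) (concat-unique js js!) disjoint
    where
    disjoint : ∀ {xs} → xs ∈ partsStartingWith f (suc n) j × xs ∈ concatMap (partsStartingWith f (suc n)) js → ⊥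
    disjoint (xs∈ , xs∈′)
      with ∈-map⁻ (j ∷_) xs∈ | find (∈-concatMap⁻ (partsStartingWith f (suc n)) {xs = js} xs∈′)
    ... | _ , _ , refl | j′ , j′∈js , xs∈ⱼ′ with ∈-map⁻ (j′ ∷_) xs∈ⱼ′
    ... | _ , _ , j∷≡j′∷ = All.lookup j∉js j′∈js (proj₁ (∷-injective j∷≡j′∷))

all≤sum : ∀ xs → All (_≤ sum xs) xs
all≤sum [] = []
all≤sum (x ∷ xs) = m≤m+n x (sum xs) ∷ All.map (λ y≤Σ → ≤-trans y≤Σ (m≤n+m (sum xs) x)) (all≤sum xs)

∈-partitions⁻ : ∀ {n xs} → xs ∈ partitions n → Nonincreasing xs × All (0 <_) xs × sum xs ≡ n
∈-partitions⁻ {n} xs∈ = let (xs↓ , xs>0 , Σxs , _) = partsFuel-sound n n n xs∈ in xs↓ , xs>0 , Σxs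

∈-partitions⁺ : ∀ {xs} → Nonincreasing xs → All (0 <_) xs → xs ∈ partitions (sum xs)
∈-partitions⁺ {xs} xs↓ xs>0 = partsFuel-complete (sum xs) (sum xs) xs↓ xs>0 (all≤sum xs) ≤-refl

partitions-unique : ∀ n → Unique (partitions n)
partitions-unique n = partsFuel-unique n n n

-- Multiplicities

mult-∷-≡ : ∀ x xs → mult x (x ∷ xs) ≡ suc (mult x xs)
mult-∷-≡ x xs = cong length (filter-accept (_≟ x) {xs = xs} refl)

mult-∷-≢ : ∀ {x v} xs → x ≢ v → mult v (x ∷ xs) ≡ mult v xs
mult-∷-≢ xs x≢v = cong length (filter-reject (_≟ _) {xs = xs} x≢v)

mult-none : ∀ {v xs} → All (_≢ v) xs → mult v xs ≡ 0
mult-none [] = refl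
mult-none {xs = _ ∷ xs} (x≢v ∷ xs≢v) = trans (mult-∷-≢ xs x≢v) (mult-none xs≢v)

mult-++ : ∀ v xs ys → mult v (xs ++ ys) ≡ mult v xs + mult v ys
mult-++ v xs ys = trans (cong length (filter-++ (_≟ v) xs ys)) (length-++ (filter (_≟ v) xs))

mult-replicate : ∀ v e → mult v (replicate e v) ≡ e
mult-replicate v zero = refl
mult-replicate v (suc e) = trans (mult-∷-≡ v (replicate e v)) (cong suc (mult-replicate v e))

mult-filter : ∀ {Q : ℕ → Set} (Q? : Decidable Q) {v} → Q v → ∀ xs → mult v (filter Q? xs) ≡ mult v xs
mult-filter Q? Qv [] = refl
mult-filter {Q} Q? {v} Qv (x ∷ xs) with Q? x
... | no ¬Qx = trans (mult-filter Q? Qv xs) (sym (mult-∷-≢ xs λ x≡v → ¬Qx (subst Q (sym x≡v) Qv)))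
... | yes _ with x ≟ v
...   | yes refl = trans (mult-∷-≡ x _) (trans (cong suc (mult-filter Q? Qv xs)) (sym (mult-∷-≡ x xs)))
...   | no x≢v = trans (mult-∷-≢ _ x≢v) (trans (mult-filter Q? Qv xs) (sym (mult-∷-≢ xs x≢v)))

mult-map-+ : ∀ c v xs → mult (c + v) (map (c +_) xs) ≡ mult v xs
mult-map-+ c v [] = refl
mult-map-+ c v (x ∷ xs) with x ≟ v
... | yes refl = trans (mult-∷-≡ (c + x) _) (trans (cong suc (mult-map-+ c x xs)) (sym (mult-∷-≡ x xs)))
... | no x≢v = begin
  mult (c + v) (c + x ∷ map (c +_) xs) ≡⟨ mult-∷-≢ _ (λ c+x≡c+v → x≢v (+-cancelˡ-≡ c x v c+x≡c+v)) ⟩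
  mult (c + v) (map (c +_) xs)         ≡⟨ mult-map-+ c v xs ⟩
  mult v xs                            ≡⟨ mult-∷-≢ xs x≢v ⟨
  mult v (x ∷ xs)                      ∎
  where open ≡-Reasoning

mult-head< : ∀ {x v xs} → Nonincreasing (x ∷ xs) → x < v → mult v (x ∷ xs) ≡ 0
mult-head< (xs≤x ∷ _) x<v = mult-none (<⇒≢ x<v ∷ All.map (λ y≤x → <⇒≢ (≤-<-trans y≤x x<v)) xs≤x)

Nonincreasing-mult⇒≡ : ∀ {xs ys} → Nonincreasing xs → Nonincreasing ys →
  (∀ v → mult v xs ≡ mult v ys) → xs ≡ ys
Nonincreasing-mult⇒≡ [] [] _ = refl
Nonincreasing-mult⇒≡ [] (_∷_ {y} {ys} _ _) same = contradiction (trans (same y) (mult-∷-≡ y ys)) 0≢1+n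
Nonincreasing-mult⇒≡ (_∷_ {x} {xs} _ _) [] same = contradiction (trans (sym (same x)) (mult-∷-≡ x xs)) 0≢1+n
Nonincreasing-mult⇒≡ {x ∷ xs} {y ∷ ys} xxs↓@(_ ∷ xs↓) yys↓@(_ ∷ ys↓) same with <-cmp x y
... | tri< x<y _ _ = contradiction (trans (sym (mult-head< xxs↓ x<y)) (trans (same y) (mult-∷-≡ y ys))) 0≢1+n
... | tri> _ _ y<x = contradiction (trans (sym (mult-head< yys↓ y<x)) (trans (sym (same x)) (mult-∷-≡ x xs))) 0≢1+n
... | tri≈ _ refl _ = cong (x ∷_) (Nonincreasing-mult⇒≡ xs↓ ys↓ sameTail)
  where
  sameTail : ∀ v → mult v xs ≡ mult v ys
  sameTail v with x ≟ v
  ... | yes refl = suc-injective (trans (sym (mult-∷-≡ x xs)) (trans (same x) (mult-∷-≡ x ys)))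
  ... | no x≢v = trans (sym (mult-∷-≢ xs x≢v)) (trans (same v) (mult-∷-≢ ys x≢v))

-- Suffix sums, differences and weights

suffixSums : List ℕ → List ℕ
suffixSums [] = []
suffixSums (d ∷ ds) = d + sum ds ∷ suffixSums ds

head₀ : List ℕ → ℕ
head₀ [] = 0
head₀ (k ∷ _) = k

differences : List ℕ → List ℕ
differences [] = []
differences (k ∷ ks) = k ∸ head₀ ks ∷ differences ks

-- weight ds = Σᵢ (i + 1) · dᵢ
weight : List ℕ → ℕ
weight ds = sum (suffixSums ds)

length-suffixSums : ∀ ds → length (suffixSums ds) ≡ length ds
length-suffixSums [] = refl
length-suffixSums (_ ∷ ds) = cong suc (length-suffixSums ds)

length-differences : ∀ ks → length (differences ks) ≡ length ks
length-differences [] = refl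
length-differences (_ ∷ ks) = cong suc (length-differences ks)

head₀-suffixSums : ∀ ds → head₀ (suffixSums ds) ≡ sum ds
head₀-suffixSums [] = refl
head₀-suffixSums (_ ∷ _) = refl

suffixSums-≤-sum : ∀ ds → All (_≤ sum ds) (suffixSums ds)
suffixSums-≤-sum [] = []
suffixSums-≤-sum (d ∷ ds) = ≤-refl ∷ All.map (λ s≤Σ → ≤-trans s≤Σ (m≤n+m (sum ds) d)) (suffixSums-≤-sum ds)

Nonincreasing-suffixSums : ∀ ds → Nonincreasing (suffixSums ds)
Nonincreasing-suffixSums [] = []
Nonincreasing-suffixSums (d ∷ ds) = All.tail (suffixSums-≤-sum (d ∷ ds)) ∷ Nonincreasing-suffixSums ds

differences-suffixSums : ∀ ds → differences (suffixSums ds) ≡ ds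
differences-suffixSums [] = refl
differences-suffixSums (d ∷ ds) = cong₂ _∷_
  (trans (cong (d + sum ds ∸_) (head₀-suffixSums ds)) (m+n∸n≡m d (sum ds)))
  (differences-suffixSums ds)

suffixSums-differences : ∀ {ks} → Nonincreasing ks → suffixSums (differences ks) ≡ ks
suffixSums-differences [] = refl
suffixSums-differences {k ∷ ks} (ks≤k ∷ ks↓) = cong₂ _∷_ (begin
    k ∸ head₀ ks + sum (differences ks) ≡⟨ cong (k ∸ head₀ ks +_) sum-differences ⟩
    k ∸ head₀ ks + head₀ ks             ≡⟨ m∸n+n≡m (head₀≤ ks≤k) ⟩
    k                                   ∎)
  IH
  where
  open ≡-Reasoning
  IH = suffixSums-differences ks↓
  sum-differences : sum (differences ks) ≡ head₀ ks
  sum-differences = trans (sym (head₀-suffixSums (differences ks))) (cong head₀ IH)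
  head₀≤ : ∀ {ls} → All (_≤ k) ls → head₀ ls ≤ k
  head₀≤ [] = z≤n
  head₀≤ (l≤k ∷ _) = l≤k

-- Multiples of m

lookup₀ : List ℕ → ℕ → ℕ
lookup₀ [] _ = 0
lookup₀ (e ∷ _) zero = e
lookup₀ (_ ∷ es) (suc i) = lookup₀ es i

applyUpTo-cong : ∀ {A : Set} {f g : ℕ → A} n → (∀ i → f i ≡ g i) → applyUpTo f n ≡ applyUpTo g n
applyUpTo-cong zero _ = refl
applyUpTo-cong (suc n) f≗g = cong₂ _∷_ (f≗g 0) (applyUpTo-cong n (λ i → f≗g (suc i)))

applyUpTo-lookup₀ : ∀ es → applyUpTo (lookup₀ es) (length es) ≡ es
applyUpTo-lookup₀ [] = refl
applyUpTo-lookup₀ (e ∷ es) = cong (e ∷_) (applyUpTo-lookup₀ es)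

lookup₀-applyUpTo-< : ∀ (f : ℕ → ℕ) {n i} → i < n → lookup₀ (applyUpTo f n) i ≡ f i
lookup₀-applyUpTo-< f {suc n} {zero} _ = refl
lookup₀-applyUpTo-< f {suc n} {suc i} (s≤s i<n) = lookup₀-applyUpTo-< (λ j → f (suc j)) i<n

lookup₀-applyUpTo-≥ : ∀ (f : ℕ → ℕ) {n i} → n ≤ i → lookup₀ (applyUpTo f n) i ≡ 0
lookup₀-applyUpTo-≥ f {zero} _ = refl
lookup₀-applyUpTo-≥ f {suc n} {suc i} (s≤s n≤i) = lookup₀-applyUpTo-≥ (λ j → f (suc j)) n≤i

sum-replicate : ∀ e v → sum (replicate e v) ≡ e * v
sum-replicate zero _ = refl
sum-replicate (suc e) v = cong (v +_) (sum-replicate e v)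

sum-map-+ : ∀ c xs → sum (map (c +_) xs) ≡ length xs * c + sum xs
sum-map-+ c [] = refl
sum-map-+ c (x ∷ xs) = trans (cong (c + x +_) (sum-map-+ c xs)) (shuffle c x (length xs) (sum xs))
  where
  shuffle : ∀ c x l s → c + x + (l * c + s) ≡ c + l * c + (x + s)
  shuffle = solve-∀

replicate⁺-nonempty : ∀ {P : ℕ → Set} {v} e → (0 < e → P v) → All P (replicate e v)
replicate⁺-nonempty zero _ = []
replicate⁺-nonempty (suc e) Pv = AllP.replicate⁺ (suc e) (Pv z<s)

module Multiples (m : ℕ) .{{_ : NonZero m}} where

  mult-none-% : ∀ {r v xs} → All (λ p → p % m ≡ r) xs → v % m ≢ r → mult v xs ≡ 0
  mult-none-% {r} xs%m≡r v%m≢r =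
    mult-none (All.map (λ p%m≡r p≡v → v%m≢r (subst (λ q → q % m ≡ r) p≡v p%m≡r)) xs%m≡r)

  -- fromMultiplicities es has eᵢ parts equal to (i + 1) · m.
  fromMultiplicities : List ℕ → List ℕ
  fromMultiplicities [] = []
  fromMultiplicities (e ∷ es) = map (m +_) (fromMultiplicities es) ++ replicate e m

  fromMultiplicities-%≡0 : ∀ es → All (λ p → p % m ≡ 0) (fromMultiplicities es)
  fromMultiplicities-%≡0 [] = []
  fromMultiplicities-%≡0 (e ∷ es) = AllP.++⁺
    (AllP.map⁺ (All.map (λ p%m≡0 → trans (%-remove-+ˡ _ ∣-refl) p%m≡0) (fromMultiplicities-%≡0 es)))
    (AllP.replicate⁺ e (n%n≡0 m))

  fromMultiplicities-≥ : ∀ es → All (m ≤_) (fromMultiplicities es)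
  fromMultiplicities-≥ [] = []
  fromMultiplicities-≥ (e ∷ es) =
    AllP.++⁺ (AllP.map⁺ (All.universal (m≤m+n m) _)) (AllP.replicate⁺ e ≤-refl)

  fromMultiplicities-≤ : ∀ es → All (_≤ length es * m) (fromMultiplicities es)
  fromMultiplicities-≤ [] = []
  fromMultiplicities-≤ (e ∷ es) =
    AllP.++⁺ (AllP.map⁺ (All.map (+-monoʳ-≤ m) (fromMultiplicities-≤ es))) (AllP.replicate⁺ e (m≤m+n m _))

  Nonincreasing-fromMultiplicities : ∀ es → Nonincreasing (fromMultiplicities es)
  Nonincreasing-fromMultiplicities [] = []
  Nonincreasing-fromMultiplicities (e ∷ es) = AllPairs.++⁺
    (AllPairs.map⁺ (AllPairs.map (+-monoʳ-≤ m) (Nonincreasing-fromMultiplicities es)))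
    (Nonincreasing-replicate e m)
    (AllP.map⁺ (All.universal (λ p → AllP.replicate⁺ e (m≤m+n m p)) _))

  length-fromMultiplicities : ∀ es → length (fromMultiplicities es) ≡ sum es
  length-fromMultiplicities [] = refl
  length-fromMultiplicities (e ∷ es) = begin
    length (map (m +_) F ++ replicate e m)      ≡⟨ length-++ (map (m +_) F) ⟩
    length (map (m +_) F) + length (replicate e m) ≡⟨ cong₂ _+_ (length-map (m +_) F) (length-replicate e) ⟩
    length F + e                                ≡⟨ cong (_+ e) (length-fromMultiplicities es) ⟩
    sum es + e                                  ≡⟨ +-comm (sum es) e ⟩
    e + sum es                                  ∎
    where
    open ≡-Reasoning
    F = fromMultiplicities es

  sum-fromMultiplicities : ∀ es → sum (fromMultiplicities es) ≡ weight es * m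
  sum-fromMultiplicities [] = refl
  sum-fromMultiplicities (e ∷ es) = begin
    sum (map (m +_) F ++ replicate e m)              ≡⟨ sum-++ (map (m +_) F) (replicate e m) ⟩
    sum (map (m +_) F) + sum (replicate e m)         ≡⟨ cong₂ _+_ (sum-map-+ m F) (sum-replicate e m) ⟩
    length F * m + sum F + e * m                     ≡⟨ cong₂ (λ l s → l * m + s + e * m)
                                                          (length-fromMultiplicities es) (sum-fromMultiplicities es) ⟩
    sum es * m + weight es * m + e * m               ≡⟨ regroup (sum es) (weight es) e m ⟩
    (e + sum es + weight es) * m                     ∎
    where
    open ≡-Reasoning
    F = fromMultiplicities es
    regroup : ∀ s w e m → s * m + w * m + e * m ≡ (e + s + w) * m
    regroup = solve-∀

  mult-0-fromMultiplicities : ∀ es → mult 0 (fromMultiplicities es) ≡ 0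
  mult-0-fromMultiplicities es =
    mult-none (All.map (λ m≤p → >⇒≢ (<-≤-trans (>-nonZero⁻¹ m) m≤p)) (fromMultiplicities-≥ es))

  mult-fromMultiplicities : ∀ es i → mult (suc i * m) (fromMultiplicities es) ≡ lookup₀ es i
  mult-fromMultiplicities [] i = refl
  mult-fromMultiplicities (e ∷ es) zero = begin
    mult (m + 0) (map (m +_) F ++ replicate e m)           ≡⟨ mult-++ (m + 0) (map (m +_) F) (replicate e m) ⟩
    mult (m + 0) (map (m +_) F) + mult (m + 0) (replicate e m)
      ≡⟨ cong₂ _+_ (mult-map-+ m 0 F) (cong (λ v → mult v (replicate e m)) (+-identityʳ m)) ⟩
    mult 0 F + mult m (replicate e m)                      ≡⟨ cong₂ _+_ (mult-0-fromMultiplicities es) (mult-replicate m e) ⟩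
    e                                                      ∎
    where
    open ≡-Reasoning
    F = fromMultiplicities es
  mult-fromMultiplicities (e ∷ es) (suc i) = begin
    mult (m + suc i * m) (map (m +_) F ++ replicate e m)   ≡⟨ mult-++ _ (map (m +_) F) (replicate e m) ⟩
    mult (m + suc i * m) (map (m +_) F) + mult (m + suc i * m) (replicate e m)
      ≡⟨ cong₂ _+_ (mult-map-+ m (suc i * m) F) (mult-none (AllP.replicate⁺ e (<⇒≢ m<m+[1+i]m))) ⟩
    mult (suc i * m) F + 0                                 ≡⟨ +-identityʳ _ ⟩
    mult (suc i * m) F                                     ≡⟨ mult-fromMultiplicities es i ⟩
    lookup₀ es i                                           ∎
    where
    open ≡-Reasoning
    F = fromMultiplicities es
    m<m+[1+i]m : m < m + suc i * m
    m<m+[1+i]m = m<m+n m (<-≤-trans (>-nonZero⁻¹ m) (m≤m+n m (i * m)))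

-- Capsids

-- encode (ds , es) is the capsid with β = length ds and α = length es = a whose parts ≡ r₂ are r₂ + (a + k) · m
-- for k in suffixSums ds, and whose parts ≡ 0 have multiplicity vector es on {m, 2m, …, a · m}.
module Encoding (m : ℕ) .{{_ : NonZero m}} (r₁ r₂ : ℕ) where

  open Multiples m

  raise : ℕ → ℕ → ℕ
  raise a k = r₂ + (a + k) * m

  lower : ℕ → ℕ → ℕ
  lower a p = p / m ∸ a

  encode : List ℕ × List ℕ → List ℕ
  encode (ds , es) =
    map (raise (length es)) (suffixSums ds) ++ (fromMultiplicities es ++ replicate (length es) r₁)

  ≡r₂? : Decidable (λ p → p % m ≡ r₂)
  ≡r₂? p = p % m ≟ r₂

  decode : List ℕ → List ℕ × List ℕ
  decode x =
    differences (map (lower (mult r₁ x)) (filter ≡r₂? x)) , applyUpTo (λ i → mult (suc i * m) x) (mult r₁ x)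

  size : List ℕ → List ℕ → ℕ
  size ds es = length ds * r₂ + length es * r₁ + (length ds * length es + weight ds + weight es) * m

  length-decode₁ : ∀ x → length (proj₁ (decode x)) ≡ countRes m r₂ x
  length-decode₁ x = trans (length-differences (map (lower (mult r₁ x)) (filter ≡r₂? x)))
                            (length-map (lower (mult r₁ x)) (filter ≡r₂? x))

  length-decode₂ : ∀ x → length (proj₂ (decode x)) ≡ mult r₁ x
  length-decode₂ x = length-applyUpTo _ (mult r₁ x)

size-swap : ∀ m .{{_ : NonZero m}} r₁ r₂ ds es → Encoding.size m r₁ r₂ ds es ≡ Encoding.size m r₂ r₁ es ds
size-swap m r₁ r₂ ds es = regroup (length ds) (length es) (weight ds) (weight es) r₁ r₂ m
  where
  regroup : ∀ l l′ w w′ r₁ r₂ m →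
    l * r₂ + l′ * r₁ + (l * l′ + w + w′) * m ≡ l′ * r₁ + l * r₂ + (l′ * l + w′ + w) * m
  regroup = solve-∀

module Capsids (m : ℕ) .{{_ : NonZero m}} (r₁ r₂ : ℕ)
  (0<r₁ : 0 < r₁) (r₁<m : r₁ < m) (0<r₂ : 0 < r₂) (r₂<m : r₂ < m) (r₁≢r₂ : r₁ ≢ r₂) where

  open Multiples m
  open Encoding m r₁ r₂

  r₁%m≡r₁ : r₁ % m ≡ r₁
  r₁%m≡r₁ = m<n⇒m%n≡m r₁<m

  r₂%m≡r₂ : r₂ % m ≡ r₂
  r₂%m≡r₂ = m<n⇒m%n≡m r₂<m

  ≡r₂⇒≢r₁ : ∀ {p} → p % m ≡ r₂ → p ≢ r₁
  ≡r₂⇒≢r₁ p%m≡r₂ refl = r₁≢r₂ (trans (sym r₁%m≡r₁) p%m≡r₂)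

  ≡0⇒≢r₁ : ∀ {p} → p % m ≡ 0 → p ≢ r₁
  ≡0⇒≢r₁ p%m≡0 refl = >⇒≢ 0<r₁ (trans (sym r₁%m≡r₁) p%m≡0)

  ≡0⇒≢r₂ : ∀ {p} → p % m ≡ 0 → p % m ≢ r₂
  ≡0⇒≢r₂ p%m≡0 p%m≡r₂ = >⇒≢ 0<r₂ (trans (sym p%m≡r₂) p%m≡0)

  ≡r₂⇒≢0 : ∀ {p} → p % m ≡ r₂ → p % m ≢ 0
  ≡r₂⇒≢0 p%m≡r₂ p%m≡0 = ≡0⇒≢r₂ p%m≡0 p%m≡r₂

  raise-% : ∀ a k → raise a k % m ≡ r₂
  raise-% a k = trans ([m+kn]%n≡m%n r₂ (a + k) m) r₂%m≡r₂

  raise-> : ∀ a k → a * m < raise a k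
  raise-> a k = <-≤-trans (m<n+m (a * m) 0<r₂) (+-monoʳ-≤ r₂ (*-monoˡ-≤ m (m≤m+n a k)))

  raise-mono : ∀ a {k l} → k ≤ l → raise a k ≤ raise a l
  raise-mono a k≤l = +-monoʳ-≤ r₂ (*-monoˡ-≤ m (+-monoʳ-≤ a k≤l))

  lower-mono : ∀ a {p q} → p ≤ q → lower a p ≤ lower a q
  lower-mono a p≤q = ∸-monoˡ-≤ a (/-monoˡ-≤ m p≤q)

  lower-raise : ∀ a k → lower a (raise a k) ≡ k
  lower-raise a k = begin
    (r₂ + (a + k) * m) / m ∸ a      ≡⟨ cong (_∸ a) (+-distrib-/-∣ʳ r₂ (n∣m*n (a + k))) ⟩
    r₂ / m + (a + k) * m / m ∸ a    ≡⟨ cong₂ (λ u v → u + v ∸ a) (m<n⇒m/n≡0 r₂<m) (m*n/n≡m (a + k) m) ⟩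
    a + k ∸ a                       ≡⟨ m+n∸m≡n a k ⟩
    k                               ∎
    where open ≡-Reasoning

  raise-lower : ∀ a {p} → p % m ≡ r₂ → a * m < p → raise a (lower a p) ≡ p
  raise-lower a {p} p%m≡r₂ am<p = begin
    r₂ + (a + (p / m ∸ a)) * m    ≡⟨ cong (λ q → r₂ + q * m) (m+[n∸m]≡n a≤p/m) ⟩
    r₂ + p / m * m                ≡⟨ p≡ ⟨
    p                             ∎
    where
    open ≡-Reasoning
    p≡ : p ≡ r₂ + p / m * m
    p≡ = trans (m≡m%n+[m/n]*n p m) (cong (_+ p / m * m) p%m≡r₂)
    a≤p/m : a ≤ p / m
    a≤p/m = s≤s⁻¹ (*-cancelʳ-< m a (suc (p / m))
      (<-≤-trans am<p (≤-trans (≤-reflexive p≡) (<⇒≤ (+-monoˡ-< (p / m * m) r₂<m)))))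

  r₁<raise : ∀ a k → 0 < a → r₁ < raise a k
  r₁<raise (suc a) k _ = <-trans (<-≤-trans r₁<m (m≤m+n m (a * m))) (raise-> (suc a) k)

  sum-map-raise : ∀ a ks → sum (map (raise a) ks) ≡ length ks * r₂ + (length ks * a + sum ks) * m
  sum-map-raise a [] = refl
  sum-map-raise a (k ∷ ks) =
    trans (cong (raise a k +_) (sum-map-raise a ks)) (regroup r₂ a k m (length ks) (sum ks))
    where
    regroup : ∀ r a k m l s →
      r + (a + k) * m + (l * r + (l * a + s) * m) ≡ (r + l * r) + ((a + l * a) + (k + s)) * m
    regroup = solve-∀

  module _ (ds es : List ℕ) where
    private
      a = length es
      R = map (raise a) (suffixSums ds)
      Z = fromMultiplicities es
      E = replicate a r₁

      R-% : All (λ p → p % m ≡ r₂) R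
      R-% = AllP.map⁺ (All.universal (raise-% a) (suffixSums ds))

      Z-% : All (λ p → p % m ≡ 0) Z
      Z-% = fromMultiplicities-%≡0 es

    Nonincreasing-encode : Nonincreasing (encode (ds , es))
    Nonincreasing-encode = AllPairs.++⁺
      (AllPairs.map⁺ (AllPairs.map (raise-mono a) (Nonincreasing-suffixSums ds)))
      (AllPairs.++⁺ (Nonincreasing-fromMultiplicities es) (Nonincreasing-replicate a r₁)
        (All.map (λ m≤p → AllP.replicate⁺ a (<⇒≤ (<-≤-trans r₁<m m≤p))) (fromMultiplicities-≥ es)))
      (AllP.map⁺ (All.universal (λ k → AllP.++⁺
        (All.map (λ p≤am → <⇒≤ (≤-<-trans p≤am (raise-> a k))) (fromMultiplicities-≤ es))
        (replicate⁺-nonempty a (λ 0<a → <⇒≤ (r₁<raise a k 0<a)))) (suffixSums ds)))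

    encode-positive : All (0 <_) (encode (ds , es))
    encode-positive = AllP.++⁺
      (AllP.map⁺ (All.universal (λ k → <-≤-trans 0<r₂ (m≤m+n r₂ _)) (suffixSums ds)))
      (AllP.++⁺ (All.map (<-≤-trans (>-nonZero⁻¹ m)) (fromMultiplicities-≥ es)) (AllP.replicate⁺ a 0<r₁))

    sum-encode : sum (encode (ds , es)) ≡ size ds es
    sum-encode = begin
      sum (R ++ Z ++ E)              ≡⟨ sum-++ R (Z ++ E) ⟩
      sum R + sum (Z ++ E)           ≡⟨ cong (sum R +_) (sum-++ Z E) ⟩
      sum R + (sum Z + sum E)
        ≡⟨ cong₂ (λ u v → u + (v + sum E)) (sum-map-raise a (suffixSums ds)) (sum-fromMultiplicities es) ⟩
      length (suffixSums ds) * r₂ + (length (suffixSums ds) * a + weight ds) * m + (weight es * m + sum E)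
        ≡⟨ cong₂ (λ l s → l * r₂ + (l * a + weight ds) * m + (weight es * m + s))
                 (length-suffixSums ds) (sum-replicate a r₁) ⟩
      length ds * r₂ + (length ds * a + weight ds) * m + (weight es * m + a * r₁)
        ≡⟨ regroup (length ds) a (weight ds) (weight es) r₁ r₂ m ⟩
      size ds es                     ∎
      where
      open ≡-Reasoning
      regroup : ∀ l a u w r₁ r₂ m →
        l * r₂ + (l * a + u) * m + (w * m + a * r₁) ≡ l * r₂ + a * r₁ + (l * a + u + w) * m
      regroup = solve-∀

    mult-r₁-encode : mult r₁ (encode (ds , es)) ≡ length es
    mult-r₁-encode = begin
      mult r₁ (R ++ Z ++ E)                   ≡⟨ mult-++ r₁ R (Z ++ E) ⟩
      mult r₁ R + mult r₁ (Z ++ E)            ≡⟨ cong (mult r₁ R +_) (mult-++ r₁ Z E) ⟩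
      mult r₁ R + (mult r₁ Z + mult r₁ E)
        ≡⟨ cong₂ (λ u v → u + (v + mult r₁ E)) (mult-none (All.map ≡r₂⇒≢r₁ R-%)) (mult-none (All.map ≡0⇒≢r₁ Z-%)) ⟩
      mult r₁ E                               ≡⟨ mult-replicate r₁ a ⟩
      a                                       ∎
      where open ≡-Reasoning

    filter-≡r₂-encode : filter ≡r₂? (encode (ds , es)) ≡ map (raise (length es)) (suffixSums ds)
    filter-≡r₂-encode = begin
      filter ≡r₂? (R ++ Z ++ E)                               ≡⟨ filter-++ ≡r₂? R (Z ++ E) ⟩
      filter ≡r₂? R ++ filter ≡r₂? (Z ++ E)                   ≡⟨ cong (filter ≡r₂? R ++_) (filter-++ ≡r₂? Z E) ⟩
      filter ≡r₂? R ++ (filter ≡r₂? Z ++ filter ≡r₂? E)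
        ≡⟨ cong₂ (λ u v → filter ≡r₂? R ++ (u ++ v)) (filter-none ≡r₂? (All.map ≡0⇒≢r₂ Z-%))
                                                      (filter-none ≡r₂? (AllP.replicate⁺ a (≡r₂⇒≢r₁′))) ⟩
      filter ≡r₂? R ++ []                                     ≡⟨ ++-identityʳ _ ⟩
      filter ≡r₂? R                                           ≡⟨ filter-all ≡r₂? R-% ⟩
      R                                                       ∎
      where
      open ≡-Reasoning
      ≡r₂⇒≢r₁′ : r₁ % m ≢ r₂
      ≡r₂⇒≢r₁′ r₁%m≡r₂ = ≡r₂⇒≢r₁ r₁%m≡r₂ refl

    countRes-encode : countRes m r₂ (encode (ds , es)) ≡ length ds
    countRes-encode = begin
      length (filter ≡r₂? (encode (ds , es))) ≡⟨ cong length filter-≡r₂-encode ⟩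
      length R                                ≡⟨ length-map (raise a) (suffixSums ds) ⟩
      length (suffixSums ds)                  ≡⟨ length-suffixSums ds ⟩
      length ds                               ∎
      where open ≡-Reasoning

    mult-multiple-encode : ∀ i → mult (suc i * m) (encode (ds , es)) ≡ lookup₀ es i
    mult-multiple-encode i = begin
      mult v (R ++ Z ++ E)              ≡⟨ mult-++ v R (Z ++ E) ⟩
      mult v R + mult v (Z ++ E)        ≡⟨ cong (mult v R +_) (mult-++ v Z E) ⟩
      mult v R + (mult v Z + mult v E)
        ≡⟨ cong₂ (λ u w → u + (mult v Z + w))
             (mult-none (All.map (λ p%m≡r₂ p≡v → ≡0⇒≢r₂ v%m≡0 (subst (λ q → q % m ≡ r₂) p≡v p%m≡r₂)) R-%))
             (mult-none (AllP.replicate⁺ a (λ r₁≡v → ≡0⇒≢r₁ v%m≡0 (sym r₁≡v)))) ⟩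
      mult v Z + 0                      ≡⟨ +-identityʳ _ ⟩
      mult v Z                          ≡⟨ mult-fromMultiplicities es i ⟩
      lookup₀ es i                      ∎
      where
      open ≡-Reasoning
      v = suc i * m
      v%m≡0 : v % m ≡ 0
      v%m≡0 = m*n%n≡0 (suc i) m

    decode-encode : decode (encode (ds , es)) ≡ (ds , es)
    decode-encode = cong₂ _,_ (begin
        differences (map (lower (mult r₁ y)) (filter ≡r₂? y))
                                                              ≡⟨ cong₂ (λ b l → differences (map (lower b) l))
                                                                       mult-r₁-encode filter-≡r₂-encode ⟩
        differences (map (lower a) R)                         ≡⟨ cong differences (map-∘ (suffixSums ds)) ⟨
        differences (map (λ k → lower a (raise a k)) (suffixSums ds))
                                                              ≡⟨ cong differences (map-id-local (All.universal (lower-raise a) _)) ⟩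
        differences (suffixSums ds)                           ≡⟨ differences-suffixSums ds ⟩
        ds                                                    ∎)
      (begin
        applyUpTo (λ i → mult (suc i * m) y) (mult r₁ y) ≡⟨ cong (applyUpTo _) mult-r₁-encode ⟩
        applyUpTo (λ i → mult (suc i * m) y) a           ≡⟨ applyUpTo-cong a mult-multiple-encode ⟩
        applyUpTo (lookup₀ es) a                         ≡⟨ applyUpTo-lookup₀ es ⟩
        es                                               ∎)
      where
      open ≡-Reasoning
      y = encode (ds , es)

    IsCapsid-encode : IsCapsid m r₁ r₂ (encode (ds , es))
    IsCapsid-encode = allowed , onlyR , bounded
      where
      y = encode (ds , es)
      r₁%m≢0 : r₁ % m ≢ 0
      r₁%m≢0 r₁%m≡0 = ≡0⇒≢r₁ r₁%m≡0 refl
      r₁%m≢r₂ : r₁ % m ≢ r₂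
      r₁%m≢r₂ r₁%m≡r₂ = ≡r₂⇒≢r₁ r₁%m≡r₂ refl
      allowed : All (λ p → p ≡ r₁ ⊎ (p % m ≡ 0 ⊎ p % m ≡ r₂)) y
      allowed = AllP.++⁺ (All.map (inj₂ ∘ inj₂) R-%)
                         (AllP.++⁺ (All.map (inj₂ ∘ inj₁) Z-%) (AllP.replicate⁺ a (inj₁ refl)))
      onlyR : mult r₁ y ≡ 0 → All (λ p → p % m ≡ r₂) y
      onlyR α≡0 = AllP.++⁺ R-% (noZE es (trans (sym mult-r₁-encode) α≡0))
        where
        noZE : ∀ fs → length fs ≡ 0 → All (λ p → p % m ≡ r₂) (fromMultiplicities fs ++ replicate (length fs) r₁)
        noZE [] _ = []
      bounded : 0 < mult r₁ y →
        All (r₁ ≤_) y ×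
        All (λ p → p % m ≡ 0 → p ≤ m * mult r₁ y) y ×
        All (λ p → p % m ≡ r₂ → m * mult r₁ y < p) y
      bounded rewrite mult-r₁-encode = λ 0<a → r₁-below 0<a , multiples-below , raised-above
        where
        r₁-below : 0 < a → All (r₁ ≤_) y
        r₁-below 0<a = AllP.++⁺
          (AllP.map⁺ (All.universal (λ k → <⇒≤ (r₁<raise a k 0<a)) (suffixSums ds)))
          (AllP.++⁺ (All.map (λ m≤p → <⇒≤ (<-≤-trans r₁<m m≤p)) (fromMultiplicities-≥ es))
                    (AllP.replicate⁺ a ≤-refl))
        multiples-below : All (λ p → p % m ≡ 0 → p ≤ m * a) y
        multiples-below = AllP.++⁺
          (All.map (λ p%m≡r₂ p%m≡0 → ⊥-elim (≡0⇒≢r₂ p%m≡0 p%m≡r₂)) R-%)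
          (AllP.++⁺ (All.map (λ {p} p≤am _ → subst (p ≤_) (*-comm a m) p≤am) (fromMultiplicities-≤ es))
                    (AllP.replicate⁺ a (⊥-elim ∘ r₁%m≢0)))
        raised-above : All (λ p → p % m ≡ r₂ → m * a < p) y
        raised-above = AllP.++⁺
          (AllP.map⁺ (All.universal (λ k _ → subst (_< raise a k) (*-comm a m) (raise-> a k)) (suffixSums ds)))
          (AllP.++⁺ (All.map (λ p%m≡0 p%m≡r₂ → ⊥-elim (≡0⇒≢r₂ p%m≡0 p%m≡r₂)) Z-%)
                    (AllP.replicate⁺ a (⊥-elim ∘ r₁%m≢r₂)))

  CapsidPart : ℕ → ℕ → Set
  CapsidPart a p = (p % m ≡ r₂ × a * m < p) ⊎ (p % m ≡ 0 × p ≤ a * m) ⊎ p ≡ r₁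

  ≡r₂⇒>0 : ∀ {p} → p % m ≡ r₂ → 0 < p
  ≡r₂⇒>0 {zero} 0%m≡r₂ = ⊥-elim (≡0⇒≢r₂ (m*n%n≡0 0 m) 0%m≡r₂)
  ≡r₂⇒>0 {suc p} _ = z<s

  IsCapsid⇒All-CapsidPart : ∀ {x} → IsCapsid m r₁ r₂ x → All (CapsidPart (mult r₁ x)) x
  IsCapsid⇒All-CapsidPart {x} (allowed , onlyR , bounded) with mult r₁ x ≟ 0
  ... | yes α≡0 =
    All.map (λ {p} p%m≡r₂ → inj₁ (p%m≡r₂ , subst (λ a → a * m < p) (sym α≡0) (≡r₂⇒>0 p%m≡r₂))) (onlyR α≡0)
  ... | no α≢0 = All.map classify (All.zip (allowed , All.zip (Z-bounded , R-bounded)))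
    where
    a = mult r₁ x
    Z-bounded = proj₁ (proj₂ (bounded (n≢0⇒n>0 α≢0)))
    R-bounded = proj₂ (proj₂ (bounded (n≢0⇒n>0 α≢0)))
    classify : ∀ {p} →
      (p ≡ r₁ ⊎ (p % m ≡ 0 ⊎ p % m ≡ r₂)) × (p % m ≡ 0 → p ≤ m * a) × (p % m ≡ r₂ → m * a < p) → CapsidPart a p
    classify (inj₁ p≡r₁ , _) = inj₂ (inj₂ p≡r₁)
    classify {p} (inj₂ (inj₁ p%m≡0) , p≤ma , _) = inj₂ (inj₁ (p%m≡0 , subst (p ≤_) (*-comm m a) (p≤ma p%m≡0)))
    classify {p} (inj₂ (inj₂ p%m≡r₂) , _ , ma<p) = inj₁ (p%m≡r₂ , subst (_< p) (*-comm m a) (ma<p p%m≡r₂))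

  module _ {x} (x↓ : Nonincreasing x) (x>0 : All (0 <_) x) (x-capsid : IsCapsid m r₁ r₂ x) where
    private
      a = mult r₁ x
      ds = proj₁ (decode x)
      es = proj₂ (decode x)
      Rx = filter ≡r₂? x
      Z = fromMultiplicities es
      E = replicate a r₁
      parts = IsCapsid⇒All-CapsidPart x-capsid

      length-es : length es ≡ a
      length-es = length-decode₂ x

      Rx-% : All (λ p → p % m ≡ r₂) Rx
      Rx-% = AllP.all-filter ≡r₂? x

      Rx-none : ∀ {v} → v % m ≢ r₂ → mult v Rx ≡ 0
      Rx-none = mult-none-% Rx-%

      Z-none : ∀ {v} → v % m ≢ 0 → mult v Z ≡ 0
      Z-none = mult-none-% (fromMultiplicities-%≡0 es)

      E-none : ∀ {v} → v ≢ r₁ → mult v E ≡ 0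
      E-none v≢r₁ = mult-none (AllP.replicate⁺ a (λ r₁≡v → v≢r₁ (sym r₁≡v)))

      raise-decode : map (raise a) (suffixSums ds) ≡ Rx
      raise-decode = begin
        map (raise a) (suffixSums (differences (map (lower a) Rx)))
          ≡⟨ cong (map (raise a)) (suffixSums-differences lowered↓) ⟩
        map (raise a) (map (lower a) Rx)      ≡⟨ map-∘ Rx ⟨
        map (λ p → raise a (lower a p)) Rx
          ≡⟨ map-id-local (All.map (λ (p%m≡r₂ , am<p) → raise-lower a p%m≡r₂ am<p) Rx-parts) ⟩
        Rx                                   ∎
        where
        open ≡-Reasoning
        lowered↓ : Nonincreasing (map (lower a) Rx)
        lowered↓ = AllPairs.map⁺ (AllPairs.map (lower-mono a) (AllPairs.filter⁺ ≡r₂? x↓))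
        narrow : ∀ {p} → CapsidPart a p × p % m ≡ r₂ → p % m ≡ r₂ × a * m < p
        narrow (inj₁ R-part , _) = R-part
        narrow (inj₂ (inj₁ (p%m≡0 , _)) , p%m≡r₂) = ⊥-elim (≡0⇒≢r₂ p%m≡0 p%m≡r₂)
        narrow (inj₂ (inj₂ p≡r₁) , p%m≡r₂) = ⊥-elim (≡r₂⇒≢r₁ p%m≡r₂ p≡r₁)
        Rx-parts : All (λ p → p % m ≡ r₂ × a * m < p) Rx
        Rx-parts = All.map narrow (All.zip (AllP.filter⁺ ≡r₂? parts , Rx-%))

      mult-multiple : ∀ q → mult (q * m) Z ≡ mult (q * m) x
      mult-multiple zero = trans (mult-0-fromMultiplicities es) (sym (mult-none (All.map >⇒≢ x>0)))
      mult-multiple (suc i) with i <? a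
      ... | yes i<a = trans (mult-fromMultiplicities es i) (lookup₀-applyUpTo-< _ i<a)
      ... | no i≮a = begin
        mult v Z                                  ≡⟨ mult-fromMultiplicities es i ⟩
        lookup₀ es i                              ≡⟨ lookup₀-applyUpTo-≥ _ (≮⇒≥ i≮a) ⟩
        0                                         ≡⟨ mult-none (All.map ≢v parts) ⟨
        mult v x                                  ∎
        where
        open ≡-Reasoning
        v = suc i * m
        v%m≡0 : v % m ≡ 0
        v%m≡0 = m*n%n≡0 (suc i) m
        am<v : a * m < v
        am<v = <-≤-trans (m<n+m (a * m) (>-nonZero⁻¹ m)) (+-monoʳ-≤ m (*-monoˡ-≤ m (≮⇒≥ i≮a)))
        ≢v : ∀ {p} → CapsidPart a p → p ≢ v
        ≢v (inj₁ (p%m≡r₂ , _)) p≡v = ≡0⇒≢r₂ v%m≡0 (subst (λ q → q % m ≡ r₂) p≡v p%m≡r₂)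
        ≢v (inj₂ (inj₁ (_ , p≤am))) p≡v = <⇒≱ am<v (subst (_≤ a * m) p≡v p≤am)
        ≢v (inj₂ (inj₂ p≡r₁)) p≡v = ≡0⇒≢r₁ v%m≡0 (trans (sym p≡v) p≡r₁)

      mult-fromMultiplicities-decode : ∀ {v} → v % m ≡ 0 → mult v Z ≡ mult v x
      mult-fromMultiplicities-decode {v} v%m≡0 =
        subst (λ w → mult w Z ≡ mult w x) (sym v≡qm) (mult-multiple (v / m))
        where
        v≡qm : v ≡ v / m * m
        v≡qm = trans (m≡m%n+[m/n]*n v m) (cong (_+ v / m * m) v%m≡0)

      mult-blocks : ∀ v → mult v Rx + (mult v Z + mult v E) ≡ mult v x
      mult-blocks v with v % m ≟ r₂ | v % m ≟ 0 | v ≟ r₁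
      ... | yes v%m≡r₂ | _ | _ = trans
        (cong₂ _+_ (mult-filter ≡r₂? v%m≡r₂ x)
                   (cong₂ _+_ (Z-none (≡r₂⇒≢0 v%m≡r₂)) (E-none (≡r₂⇒≢r₁ v%m≡r₂))))
        (+-identityʳ _)
      ... | no v%m≢r₂ | yes v%m≡0 | _ = trans
        (cong₂ _+_ (Rx-none v%m≢r₂) (cong₂ _+_ (mult-fromMultiplicities-decode v%m≡0) (E-none (≡0⇒≢r₁ v%m≡0))))
        (+-identityʳ _)
      ... | no v%m≢r₂ | no v%m≢0 | yes refl =
        cong₂ _+_ (Rx-none v%m≢r₂) (cong₂ _+_ (Z-none v%m≢0) (mult-replicate r₁ a))
      ... | no v%m≢r₂ | no v%m≢0 | no v≢r₁ = trans
        (cong₂ _+_ (Rx-none v%m≢r₂) (cong₂ _+_ (Z-none v%m≢0) (E-none v≢r₁)))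
        (sym (mult-none (All.map ≢v parts)))
        where
        ≢v : ∀ {p} → CapsidPart a p → p ≢ v
        ≢v (inj₁ (p%m≡r₂ , _)) refl = v%m≢r₂ p%m≡r₂
        ≢v (inj₂ (inj₁ (p%m≡0 , _))) refl = v%m≢0 p%m≡0
        ≢v (inj₂ (inj₂ p≡r₁)) refl = v≢r₁ p≡r₁

    encode-decode : encode (decode x) ≡ x
    encode-decode = Nonincreasing-mult⇒≡ (Nonincreasing-encode ds es) x↓ λ v → begin
      mult v (encode (ds , es))           ≡⟨ cong (mult v) blocks ⟩
      mult v (Rx ++ Z ++ E)               ≡⟨ mult-++ v Rx (Z ++ E) ⟩
      mult v Rx + mult v (Z ++ E)         ≡⟨ cong (mult v Rx +_) (mult-++ v Z E) ⟩
      mult v Rx + (mult v Z + mult v E)   ≡⟨ mult-blocks v ⟩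
      mult v x                            ∎
      where
      open ≡-Reasoning
      blocks : encode (ds , es) ≡ Rx ++ Z ++ E
      blocks = trans (cong (λ b → map (raise b) (suffixSums ds) ++ Z ++ replicate b r₁) length-es)
                     (cong (_++ Z ++ E) raise-decode)

CapsidWith : (m : ℕ) .{{_ : NonZero m}} → ℕ → ℕ → ℕ → ℕ → List ℕ → Set
CapsidWith m r₁ r₂ a b x = IsCapsid m r₁ r₂ x × α m r₁ r₂ x ≡ a × β m r₁ r₂ x ≡ b

dual : (m : ℕ) .{{_ : NonZero m}} → ℕ → ℕ → List ℕ → List ℕ
dual m r₁ r₂ x = Encoding.encode m r₂ r₁ (swap (Encoding.decode m r₁ r₂ x))

module _ (m : ℕ) .{{_ : NonZero m}} {r₁ r₂ : ℕ}
  (0<r₁ : 0 < r₁) (r₁<m : r₁ < m) (0<r₂ : 0 < r₂) (r₂<m : r₂ < m) (r₁≢r₂ : r₁ ≢ r₂) where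

  private
    module C = Capsids m r₁ r₂ 0<r₁ r₁<m 0<r₂ r₂<m r₁≢r₂
    module C′ = Capsids m r₂ r₁ 0<r₂ r₂<m 0<r₁ r₁<m (≢-sym r₁≢r₂)

  dual-capsid : ∀ {a b n x} → x ∈ partitions n → CapsidWith m r₁ r₂ a b x →
    dual m r₁ r₂ x ∈ partitions n × CapsidWith m r₂ r₁ b a (dual m r₁ r₂ x) × dual m r₂ r₁ (dual m r₁ r₂ x) ≡ x
  dual-capsid {a} {b} {n} {x} x∈ (x-capsid , αx≡a , βx≡b) =
    y∈ , (C′.IsCapsid-encode es ds , αy≡b , βy≡a) , dual-dual
    where
    open ≡-Reasoning
    x-partition = ∈-partitions⁻ {n} x∈
    x↓ = proj₁ x-partition
    x>0 = proj₁ (proj₂ x-partition)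
    ds = proj₁ (Encoding.decode m r₁ r₂ x)
    es = proj₂ (Encoding.decode m r₁ r₂ x)
    y = dual m r₁ r₂ x
    Σy≡n : sum y ≡ n
    Σy≡n = begin
      sum y                                   ≡⟨ C′.sum-encode es ds ⟩
      Encoding.size m r₂ r₁ es ds             ≡⟨ size-swap m r₁ r₂ ds es ⟨
      Encoding.size m r₁ r₂ ds es             ≡⟨ C.sum-encode ds es ⟨
      sum (Encoding.encode m r₁ r₂ (ds , es)) ≡⟨ cong sum (C.encode-decode x↓ x>0 x-capsid) ⟩
      sum x                                   ≡⟨ proj₂ (proj₂ x-partition) ⟩
      n                                       ∎
    y∈ : y ∈ partitions n
    y∈ = subst (λ k → y ∈ partitions k) Σy≡n
               (∈-partitions⁺ (C′.Nonincreasing-encode es ds) (C′.encode-positive es ds))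
    αy≡b : α m r₂ r₁ y ≡ b
    αy≡b = trans (C′.mult-r₁-encode es ds) (trans (Encoding.length-decode₁ m r₁ r₂ x) βx≡b)
    βy≡a : β m r₂ r₁ y ≡ a
    βy≡a = trans (C′.countRes-encode es ds) (trans (Encoding.length-decode₂ m r₁ r₂ x) αx≡a)
    dual-dual : dual m r₂ r₁ y ≡ x
    dual-dual = trans (cong (Encoding.encode m r₁ r₂ ∘ swap) (C′.decode-encode es ds))
                      (C.encode-decode x↓ x>0 x-capsid)

-- The hypothesis 2 ≤ m is implied by 0 < r₁, r₂ < m and r₁ ≢ r₂.
mainTheorem5 : (m r₁ r₂ : ℕ) .{{_ : NonZero m}} → 2 ≤ m → 0 < r₁ → r₁ < m → 0 < r₂ → r₂ < m → r₁ ≢ r₂ →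
    (a b n : ℕ) → γ m r₁ r₂ a b n ≡ γ m r₂ r₁ b a n
mainTheorem5 m r₁ r₂ _ 0<r₁ r₁<m 0<r₂ r₂<m r₁≢r₂ a b n =
  length-filter-≡-viaInverse _ _ (partitions-unique n) (partitions-unique n) (dual m r₁ r₂) (dual m r₂ r₁)
    (dual-capsid m 0<r₁ r₁<m 0<r₂ r₂<m r₁≢r₂ {n = n})
    (dual-capsid m 0<r₂ r₂<m 0<r₁ r₁<m (≢-sym r₁≢r₂) {n = n})
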